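{- Let $G$ be a simple disjunction or a simple formula. For any interpretations $I$ and $J$ with $J\subseteq I$, if $I\models(G^+)^{I\setminus J}_\bot$ then $J\models G$.
   Context: Infinitary propositional formulas: atoms, arbitrary conjunctions $\mathcal H^\land$, disjunctions $\mathcal H^\lor$, implications; $\top=\emptyset^\land$, $\bot=\emptyset^\lor$, $\neg F=F\to\bot$; interpretations are sets of atoms with the usual satisfaction. Extended literals: $p,\neg p,\neg\neg p$. A simple disjunction is a disjunction of extended literals; a simple implication is $\mathcal A^\land\to\mathcal L^\lor$ with $\mathcal A$ a set of atoms and $\mathcal L^\lor$ a simple disjunction; a simple formula is a conjunction of simple implications. $F^+$ denotes the result of replacing each extended literal $\neg\neg p$ in $F$ by $p$. For a set $X$ of atoms: for a simple disjunction $F$, $F^X_\bot$ is obtained by removing all disjunctive terms that belong to $X$; for a simple implication $F=\mathcal A^\land\to\mathcal L^\lor$, $F^X_\bot$ is $F$ if $\mathcal A\cap X\ne\emptyset$ and $\mathcal A^\land\to(\mathcal L^\lor)^X_\bot$ otherwise; for a simple formula it is applied to each conjunctive term. -}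

module Defs where

open import Data.Bool using (Bool; true; false; _∧_; not)
open import Data.Empty using (⊥; ⊥-elim)
open import Data.Product using (Σ; ∃; _,_; proj₁)
open import Relation.Binary.PropositionalEquality using (_≡_)

module _ {At : Set} where

  -- Infinitary propositional formulas over atoms At.
  -- A "set of formulas" H is given as an indexed family K → Formula.
  data Formula : Set₁ where
    atom : At → Formula
    ⋀    : {K : Set} → (K → Formula) → Formula
    ⋁    : {K : Set} → (K → Formula) → Formula
    _⇒_  : Formula → Formula → Formula

  ⊤F : Formula
  ⊤F = ⋀ {⊥} ⊥-elim

  ⊥F : Formula
  ⊥F = ⋁ {⊥} ⊥-elim

  ¬F : Formula → Formula
  ¬F F = F ⇒ ⊥F

  Interp : Set
  Interp = At → Bool

  _⊆I_ : Interp → Interp → Set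
  J ⊆I I = ∀ p → J p ≡ true → I p ≡ true

  _∖I_ : Interp → Interp → Interp
  (I ∖I J) p = I p ∧ not (J p)

  _⊨_ : Interp → Formula → Set
  I ⊨ atom p = I p ≡ true
  I ⊨ ⋀ {K} f = (k : K) → I ⊨ f k
  I ⊨ ⋁ {K} f = Σ K (λ k → I ⊨ f k)
  I ⊨ (F ⇒ G) = I ⊨ F → I ⊨ G

  data ExtLit : Set where
    pos    : At → ExtLit
    neg    : At → ExtLit
    negneg : At → ExtLit

  litF : ExtLit → Formula
  litF (pos p)    = atom p
  litF (neg p)    = ¬F (atom p)
  litF (negneg p) = ¬F (¬F (atom p))

  record SDisj : Set₁ where
    field
      DIdx : Set
      lit  : DIdx → ExtLit

  record SImp : Set₁ where
    field
      AIdx : Set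
      body : AIdx → At
      head : SDisj

  record SForm : Set₁ where
    field
      FIdx : Set
      imp  : FIdx → SImp

  open SDisj public
  open SImp public
  open SForm public

  sdisjF : SDisj → Formula
  sdisjF d = ⋁ (λ k → litF (lit d k))

  simpF : SImp → Formula
  simpF F = ⋀ (λ k → atom (body F k)) ⇒ sdisjF (head F)

  sformF : SForm → Formula
  sformF G = ⋀ (λ k → simpF (imp G k))

  litPlus : ExtLit → ExtLit
  litPlus (pos p)    = pos p
  litPlus (neg p)    = neg p
  litPlus (negneg p) = pos p

  sdisjPlus : SDisj → SDisj
  sdisjPlus d = record { DIdx = DIdx d ; lit = λ k → litPlus (lit d k) }

  simpPlus : SImp → SImp
  simpPlus F = record { AIdx = AIdx F ; body = body F ; head = sdisjPlus (head F) }

  sformPlus : SForm → SForm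
  sformPlus G = record { FIdx = FIdx G ; imp = λ k → simpPlus (imp G k) }

  litInX : Interp → ExtLit → Bool
  litInX X (pos p)    = X p
  litInX X (neg p)    = false
  litInX X (negneg p) = false

  -- F^X_⊥ for a simple disjunction: remove disjunctive terms belonging to X
  sdisjRed : Interp → SDisj → SDisj
  sdisjRed X d = record
    { DIdx = Σ (DIdx d) (λ k → litInX X (lit d k) ≡ false)
    ; lit  = λ k → lit d (proj₁ k) }

  -- F^X_⊥ for a simple implication, as a (functional) relation
  -- SImpRed X F F' : "F' is F^X_⊥" (the case split on A ∩ X ≠ ∅ is not
  -- decidable constructively for arbitrary index sets).
  data SImpRed (X : Interp) (F : SImp) : SImp → Set₁ where
    meets    : (k : AIdx F) → X (body F k) ≡ true → SImpRed X F F
    disjoint : (∀ k → X (body F k) ≡ false) →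
               SImpRed X F (record { AIdx = AIdx F ; body = body F
                                   ; head = sdisjRed X (head F) })

  -- F^X_⊥ for a simple formula: applied to each conjunctive term.
  -- Given g assigning to each conjunct its reduct, the reduced formula is:
  sformOf : (G : SForm) → (FIdx G → SImp) → SForm
  sformOf G g = record { FIdx = FIdx G ; imp = g }

  SFormRed : Interp → (G : SForm) → (FIdx G → SImp) → Set₁
  SFormRed X G g = ∀ k → SImpRed X (imp G k) (g k)

-- An atom true in I but not removed by the reduct w.r.t. I ∖ J is true in J, so the surviving
-- positive literals transfer from I to J; negative literals transfer because J ⊆ I, and ¬¬p
-- is implied by p, which is what G⁺ put in its place. A simple implication whose body meets
-- I ∖ J holds in J vacuously, since J makes that body false.
module Submission where

open import Data.Bool using (true; false; _∧_; not)
open import Data.Empty using (⊥; ⊥-elim)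
open import Data.Product using (_×_; _,_; proj₁)
open import Relation.Binary.PropositionalEquality using (_≡_; refl)

open import Defs

module _ {At : Set} (I J : Interp {At}) where

  ∖I-false⇒∈ : ∀ p → I p ≡ true → (I ∖I J) p ≡ false → J p ≡ true
  ∖I-false⇒∈ p Ip≡true h with I p | J p
  ... | true  | true  = refl
  ... | true  | false with () ← h
  ∖I-false⇒∈ p () h | false | _

  ∖I-true⇒∉ : ∀ p → (I ∖I J) p ≡ true → J p ≡ true → ⊥
  ∖I-true⇒∉ p h Jp≡true with I p | J p
  ... | true  | true  with () ← h
  ∖I-true⇒∉ p () Jp≡true | false | _
  ∖I-true⇒∉ p h () | true | false

  module _ (J⊆I : J ⊆I I) where

    litPlus-reduct-sound : (l : ExtLit) → litInX (I ∖I J) (litPlus l) ≡ false →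
                           I ⊨ litF (litPlus l) → J ⊨ litF l
    litPlus-reduct-sound (pos p)    kept Ip     = ∖I-false⇒∈ p Ip kept
    litPlus-reduct-sound (neg p)    _    I⊭p Jp = ⊥-elim (proj₁ (I⊭p (J⊆I p Jp)))
    litPlus-reduct-sound (negneg p) kept Ip J⊭p = J⊭p (∖I-false⇒∈ p Ip kept)

    sdisjPlus-reduct-sound : (G : SDisj) →
                             I ⊨ sdisjF (sdisjRed (I ∖I J) (sdisjPlus G)) → J ⊨ sdisjF G
    sdisjPlus-reduct-sound G ((k , kept) , I⊨l) = k , litPlus-reduct-sound (lit G k) kept I⊨l

    simpPlus-reduct-sound : (F F' : SImp) → SImpRed (I ∖I J) (simpPlus F) F' →
                            I ⊨ simpF F' → J ⊨ simpF F
    simpPlus-reduct-sound F _ (meets k k∈I∖J) _ J⊨body =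
      ⊥-elim (∖I-true⇒∉ (body F k) k∈I∖J (J⊨body k))
    simpPlus-reduct-sound F _ (disjoint _) I⊨F' J⊨body =
      sdisjPlus-reduct-sound (head F) (I⊨F' (λ k → J⊆I (body F k) (J⊨body k)))

    sformPlus-reduct-sound : (G : SForm) (g : FIdx (sformPlus G) → SImp) →
                             SFormRed (I ∖I J) (sformPlus G) g →
                             I ⊨ sformF (sformOf (sformPlus G) g) → J ⊨ sformF G
    sformPlus-reduct-sound G g red I⊨G' k =
      simpPlus-reduct-sound (imp G k) (g k) (red k) (I⊨G' k)

lemma11 : {At : Set} → (I J : Interp {At}) → J ⊆I I →
    ((G : SDisj) → I ⊨ sdisjF (sdisjRed (I ∖I J) (sdisjPlus G)) → J ⊨ sdisjF G)
    ×
    ((G : SForm) → (g : FIdx (sformPlus G) → SImp) →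
       SFormRed (I ∖I J) (sformPlus G) g →
       I ⊨ sformF (sformOf (sformPlus G) g) → J ⊨ sformF G)
lemma11 I J J⊆I = sdisjPlus-reduct-sound I J J⊆I , sformPlus-reduct-sound I J J⊆I
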